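{- Let $G$ be a finite simple graph and let $e_1=ab$ and $e_2=cd$ be edges of $G$ such that $G[\{a,b,c,d\}]$ contains a triangle or an induced $\overline{P}_3$. Then $e_1e_2$ is not an edge of $L_G$.
   Context: A biclique of $G$ is a vertex set $B\subseteq V(G)$ such that $G[B]$ is a complete bipartite graph and $B$ is inclusion-wise maximal with this property. The biclique line graph $L_G$ has vertex set $E(G)$, two edges of $G$ being adjacent iff they are both edges of $G[B]$ for some biclique $B$ of $G$. $\overline{P}_3$ is the complement of the path on three vertices, i.e. the graph on three vertices with exactly one edge. -}

module Defs where

open import Level using (0ℓ)
open import Data.Nat using (ℕ)
open import Data.Fin using (Fin)
open import Data.Fin.Subset using (Subset; _∈_; _⊆_)
open import Data.Bool using (Bool; true; false)
open import Data.Product using (Σ; ∃; _×_; _,_)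
open import Data.Sum using (_⊎_)
open import Relation.Nullary using (¬_)
open import Relation.Binary.PropositionalEquality using (_≡_; _≢_)
open import Function.Bundles using (_⇔_)

record Graph : Set₁ where
  field
    n      : ℕ
    Adj    : Fin n → Fin n → Set
    sym    : ∀ {u v} → Adj u v → Adj v u
    irrefl : ∀ {u} → ¬ Adj u u

open Graph public

module _ (G : Graph) where

  V : Set
  V = Fin (n G)

  -- G[B] is a complete bipartite graph K_{p,q} with p, q ≥ 1:
  -- B splits into two nonempty parts (side true / side false) such that
  -- two vertices of B are adjacent iff they lie in different parts.
  IsCompleteBipartite : Subset (n G) → Set
  IsCompleteBipartite B =
    Σ (V → Bool) λ side →
      (∀ u v → u ∈ B → v ∈ B → (Adj G u v ⇔ (side u ≢ side v)))
      × (Σ V λ x → x ∈ B × side x ≡ true)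
      × (Σ V λ y → y ∈ B × side y ≡ false)

  IsBiclique : Subset (n G) → Set
  IsBiclique B =
    IsCompleteBipartite B
    × (∀ B' → B ⊆ B' → IsCompleteBipartite B' → B' ⊆ B)

  -- The edges ab and cd of G are adjacent in the biclique line graph L_G:
  -- both are edges of G[B] for some biclique B (G[B] is induced, so this
  -- means a, b, c, d ∈ B).
  LGAdj : (a b c d : V) → Set
  LGAdj a b c d =
    Σ (Subset (n G)) λ B →
      IsBiclique B × a ∈ B × b ∈ B × c ∈ B × d ∈ B

  In4 : (a b c d x : V) → Set
  In4 a b c d x = x ≡ a ⊎ x ≡ b ⊎ x ≡ c ⊎ x ≡ d

  HasTriangle : (a b c d : V) → Set
  HasTriangle a b c d =
    Σ V λ x → Σ V λ y → Σ V λ z →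
      In4 a b c d x × In4 a b c d y × In4 a b c d z
      × Adj G x y × Adj G y z × Adj G x z

  -- G[{a,b,c,d}] contains an induced copy of the complement of P_3:
  -- three distinct vertices with exactly one edge (xy) among them.
  HasInducedP3bar : (a b c d : V) → Set
  HasInducedP3bar a b c d =
    Σ V λ x → Σ V λ y → Σ V λ z →
      In4 a b c d x × In4 a b c d y × In4 a b c d z
      × x ≢ z × y ≢ z
      × Adj G x y × ¬ Adj G x z × ¬ Adj G y z

-- Two-colourings have no triangles, and two vertices
-- both non-adjacent to a third lie on its side, hence are non-adjacent: so no
-- biclique contains three vertices forming a triangle or an induced P̄₃, and
-- in particular none contains all of a, b, c, d.
module Submission where

open import Defs
open import Data.Bool using (Bool; not)
open import Data.Bool.Properties using (¬-not; not-involutive) renaming (_≟_ to _≟ᵇ_)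
open import Data.Fin.Subset using (Subset; _∈_)
open import Data.Product using (_,_; proj₁; proj₂)
open import Data.Sum using (_⊎_; inj₁; inj₂)
open import Function.Bundles using (_⇔_; Equivalence)
open import Relation.Nullary using (¬_)
open import Relation.Nullary.Decidable using (decidable-stable)
open import Relation.Binary.PropositionalEquality
  using (_≡_; _≢_; refl; cong; trans) renaming (sym to ≡-sym)

≢-≢⇒≡ : {x y z : Bool} → x ≢ y → y ≢ z → x ≡ z
≢-≢⇒≡ {z = z} x≢y y≢z = trans (¬-not x≢y) (trans (cong not (¬-not y≢z)) (not-involutive z))

In4⇒∈ : (G : Graph) {B : Subset (n G)} {a b c d x : V G} →
        a ∈ B → b ∈ B → c ∈ B → d ∈ B → In4 G a b c d x → x ∈ B
In4⇒∈ G a∈B _   _   _   (inj₁ refl)                 = a∈B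
In4⇒∈ G _   b∈B _   _   (inj₂ (inj₁ refl))          = b∈B
In4⇒∈ G _   _   c∈B _   (inj₂ (inj₂ (inj₁ refl)))   = c∈B
In4⇒∈ G _   _   _   d∈B (inj₂ (inj₂ (inj₂ refl)))   = d∈B

module _ (G : Graph) {B : Subset (n G)} (bip : IsCompleteBipartite G B)
         {x y z : V G} (x∈B : x ∈ B) (y∈B : y ∈ B) (z∈B : z ∈ B) where

  private
    side = proj₁ bip

    adj⇔sides-differ : ∀ {u v} → u ∈ B → v ∈ B → Adj G u v ⇔ (side u ≢ side v)
    adj⇔sides-differ = proj₁ (proj₂ bip) _ _

    nonadj⇒same-side : ∀ {u v} → u ∈ B → v ∈ B → ¬ Adj G u v → side u ≡ side v
    nonadj⇒same-side u∈B v∈B ¬uv =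
      decidable-stable (side _ ≟ᵇ side _)
        (λ u≢v → ¬uv (Equivalence.from (adj⇔sides-differ u∈B v∈B) u≢v))

  completeBipartite⇒triangle-free : Adj G x y → Adj G y z → ¬ Adj G x z
  completeBipartite⇒triangle-free xy yz xz =
    Equivalence.to (adj⇔sides-differ x∈B z∈B) xz
      (≢-≢⇒≡ (Equivalence.to (adj⇔sides-differ x∈B y∈B) xy)
             (Equivalence.to (adj⇔sides-differ y∈B z∈B) yz))

  completeBipartite⇒P̄₃-free : ¬ Adj G x z → ¬ Adj G y z → ¬ Adj G x y
  completeBipartite⇒P̄₃-free ¬xz ¬yz xy =
    Equivalence.to (adj⇔sides-differ x∈B y∈B) xy
      (trans (nonadj⇒same-side x∈B z∈B ¬xz) (≡-sym (nonadj⇒same-side y∈B z∈B ¬yz)))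

lemma2 : (G : Graph) (a b c d : V G) →
    Adj G a b → Adj G c d →
    (HasTriangle G a b c d ⊎ HasInducedP3bar G a b c d) →
    ¬ LGAdj G a b c d
lemma2 G a b c d _ _ configuration (B , (bip , _) , a∈B , b∈B , c∈B , d∈B) =
  excluded configuration
  where
  ∈B : ∀ {x} → In4 G a b c d x → x ∈ B
  ∈B = In4⇒∈ G a∈B b∈B c∈B d∈B

  excluded : ¬ (HasTriangle G a b c d ⊎ HasInducedP3bar G a b c d)
  excluded (inj₁ (x , y , z , ix , iy , iz , xy , yz , xz)) =
    completeBipartite⇒triangle-free G bip (∈B ix) (∈B iy) (∈B iz) xy yz xz
  excluded (inj₂ (x , y , z , ix , iy , iz , _ , _ , xy , ¬xz , ¬yz)) =
    completeBipartite⇒P̄₃-free G bip (∈B ix) (∈B iy) (∈B iz) ¬xz ¬yz xy
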